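{- Let $r\in\{1,2,3\}$ and let $G$ be a strong $r$-central $2$-tree on $n$ vertices with maximum degree $\Delta$ and tail set $\{2,3\}$. Let $x$ and $y$ be the numbers of tail vertices of degree $3$ and of degree $2$, respectively. Then $x=2n+2r-6-r\Delta$ and $y=r\Delta-n-3r+6$. Consequently, once $(n,r,\Delta)$ is fixed, the degree sequence of $G$ is uniquely determined up to ordering, namely $(\Delta^{(r)},3^{(x)},2^{(y)})$.
   Context: A $2$-tree is a graph obtained from the triangle $K_3$ by repeatedly adding a new vertex adjacent to both endpoints of an existing edge. For $r\in\{1,2,3\}$ and an integer $\Delta\ge 2$, a $2$-tree on $n$ vertices is $r$-central with maximum degree $\Delta$ if $\Delta$ is its maximum degree and exactly $r$ vertices have degree $\Delta$; these $r$ vertices form the core and the other $n-r$ vertices form the tail. It is strong if the core induces $K_r$. It has tail set $\{2,3\}$ if every tail vertex has degree $2$ or $3$. The notation $d^{(k)}$ means $k$ entries equal to $d$. -}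

module Defs where

open import Data.Nat using (ℕ; zero; suc; _+_; _*_; _∸_; _≤_; _≡ᵇ_)
open import Data.Bool using (Bool; true; false; not; _∧_; _∨_; if_then_else_)
open import Data.Fin using (Fin; zero; suc; toℕ)
open import Data.Fin.Permutation using (Permutation′; _⟨$⟩ʳ_)
open import Data.Nat.ListAction using (sum)
open import Data.List using (List; map; allFin; replicate; _++_)
open import Data.Product using (Σ; _×_)
open import Relation.Binary.PropositionalEquality using (_≡_; _≢_)

Graph : ℕ → Set
Graph n = Fin n → Fin n → Bool

_==_ : ∀ {n} → Fin n → Fin n → Bool
i == j = toℕ i ≡ᵇ toℕ j

-- Labelled construction sequences of 2-trees (induction-recursion):
-- start from the triangle K₃ on Fin 3; a step adds a new vertex (labelled zero,
-- old vertices shifted by suc) adjacent to both endpoints u, v of an existing edge.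
mutual
  data TwoTreeCon : ℕ → Set where
    triangle : TwoTreeCon 3
    extend   : ∀ {n} (T : TwoTreeCon n) (u v : Fin n) → conAdj T u v ≡ true →
               TwoTreeCon (suc n)

  conAdj : ∀ {n} → TwoTreeCon n → Graph n
  conAdj triangle i j = not (i == j)
  conAdj (extend T u v _) zero    zero    = false
  conAdj (extend T u v _) zero    (suc j) = (j == u) ∨ (j == v)
  conAdj (extend T u v _) (suc i) zero    = (i == u) ∨ (i == v)
  conAdj (extend T u v _) (suc i) (suc j) = conAdj T i j

IsTwoTree : ∀ {n} → Graph n → Set
IsTwoTree {n} G =
  Σ (TwoTreeCon n) λ T → Σ (Permutation′ n) λ σ →
    ∀ i j → G i j ≡ conAdj T (σ ⟨$⟩ʳ i) (σ ⟨$⟩ʳ j)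

count : ∀ {n} → (Fin n → Bool) → ℕ
count {n} p = sum (map (λ i → if p i then 1 else 0) (allFin n))

deg : ∀ {n} → Graph n → Fin n → ℕ
deg G i = count (G i)

IsCentral : ∀ {n} → Graph n → (r Δ : ℕ) → Set
IsCentral G r Δ =
  (∀ i → deg G i ≤ Δ) × (count (λ i → deg G i ≡ᵇ Δ) ≡ r)

inCore : ∀ {n} → Graph n → ℕ → Fin n → Bool
inCore G Δ i = deg G i ≡ᵇ Δ

IsStrong : ∀ {n} → Graph n → ℕ → Set
IsStrong G Δ = ∀ i j → inCore G Δ i ≡ true → inCore G Δ j ≡ true →
               i ≢ j → G i j ≡ true

TailSet23 : ∀ {n} → Graph n → ℕ → Set
TailSet23 G Δ = ∀ i → inCore G Δ i ≡ false →
                (deg G i ≡ᵇ 2) ∨ (deg G i ≡ᵇ 3) ≡ true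

tailCount : ∀ {n} → Graph n → ℕ → ℕ → ℕ
tailCount G Δ d = count (λ i → not (inCore G Δ i) ∧ (deg G i ≡ᵇ d))

-- degree sequence (as a list, order irrelevant up to ↭)
degSeq : ∀ {n} → Graph n → List ℕ
degSeq {n} G = map (deg G) (allFin n)

-- A 2-tree on n vertices has 2n − 3 edges, since each extension adds one vertex and two
-- edges, so its degrees sum to 4n − 6. If the degree sequence consists of r copies of Δ,
-- x threes and y twos, this and n = r + x + y are two linear equations determining x and y.
module Submission where

open import Defs
open import Data.Nat using (ℕ; zero; suc; _+_; _*_; _∸_; _≤_; _≡ᵇ_)
open import Data.Nat.Properties
  using (+-0-commutativeMonoid; +-comm; +-assoc; +-cancelʳ-≡; *-suc; ≡ᵇ⇒≡; m+n∸n≡m)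
open import Data.Nat.ListAction using (sum)
open import Data.Nat.ListAction.Properties using (sum-++; sum-↭)
open import Data.Nat.Tactic.RingSolver using (solve)
open import Data.Bool using (Bool; true; false; not; _∧_; _∨_; if_then_else_; T)
open import Data.Bool.Properties using (∨-identityʳ)
open import Data.Empty using (⊥-elim)
open import Data.Fin using (Fin; zero; suc; toℕ)
open import Data.Fin.Permutation using (Permutation′; _⟨$⟩ʳ_)
open import Data.List using (List; []; _∷_; map; allFin; tabulate; length; replicate; _++_)
open import Data.List.Properties
  using (map-tabulate; map-∘; length-map; length-tabulate; length-replicate; length-++)
open import Data.List.Relation.Binary.Permutation.Propositional
  using (_↭_; ↭-refl; ↭-sym; ↭-trans; prep)
open import Data.List.Relation.Binary.Permutation.Propositional.Properties
  using (shift; ++⁺ˡ; ↭-length)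
open import Data.Product using (_×_; _,_)
open import Function using (_∘_)
open import Relation.Binary.PropositionalEquality
  using (_≡_; _≢_; refl; sym; trans; cong; cong₂; subst; subst₂; module ≡-Reasoning)
open import Algebra.Properties.CommutativeMonoid.Sum +-0-commutativeMonoid
  using (∑-distrib-+; ∑-permute; sum-cong-≗; sum-replicate-zero) renaming (sum to ∑)

open ≡-Reasoning

indicator : Bool → ℕ
indicator b = if b then 1 else 0

≡ᵇ-refl : ∀ m → (m ≡ᵇ m) ≡ true
≡ᵇ-refl zero    = refl
≡ᵇ-refl (suc m) = ≡ᵇ-refl m

sum-tabulate : ∀ {n} (f : Fin n → ℕ) → sum (tabulate f) ≡ ∑ f
sum-tabulate {zero}  f = refl
sum-tabulate {suc n} f = cong (f zero +_) (sum-tabulate (f ∘ suc))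

sum-map-allFin : ∀ {n} (f : Fin n → ℕ) → sum (map f (allFin n)) ≡ ∑ f
sum-map-allFin f = trans (cong sum (map-tabulate (λ i → i) f)) (sum-tabulate f)

sum-replicate : ∀ k a → sum (replicate k a) ≡ k * a
sum-replicate zero    a = refl
sum-replicate (suc k) a = cong (a +_) (sum-replicate k a)

degreeSum : ∀ {n} → Graph n → ℕ
degreeSum G = ∑ λ i → ∑ λ j → indicator (G i j)

sum-degSeq : ∀ {n} (G : Graph n) → sum (degSeq G) ≡ degreeSum G
sum-degSeq G =
  trans (sum-map-allFin (deg G)) (sum-cong-≗ (λ i → sum-map-allFin (indicator ∘ G i)))

degreeSum-relabel : ∀ {n} {G H : Graph n} (σ : Permutation′ n) →
  (∀ i j → G i j ≡ H (σ ⟨$⟩ʳ i) (σ ⟨$⟩ʳ j)) → degreeSum G ≡ degreeSum H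
degreeSum-relabel {G = G} {H} σ G≅H = begin
  (∑ λ i → ∑ λ j → indicator (G i j))
    ≡⟨ sum-cong-≗ (λ i → sum-cong-≗ (cong indicator ∘ G≅H i)) ⟩
  (∑ λ i → ∑ λ j → indicator (H (σ ⟨$⟩ʳ i) (σ ⟨$⟩ʳ j)))
    ≡⟨ sum-cong-≗ (λ i → sym (∑-permute (indicator ∘ H (σ ⟨$⟩ʳ i)) σ)) ⟩
  (∑ λ i → ∑ λ j → indicator (H (σ ⟨$⟩ʳ i) j))
    ≡⟨ sym (∑-permute (λ i → ∑ λ j → indicator (H i j)) σ) ⟩
  (∑ λ i → ∑ λ j → indicator (H i j)) ∎

∑-indicator-== : ∀ {n} (u : Fin n) → ∑ (λ j → indicator (j == u)) ≡ 1
∑-indicator-== {suc n} zero    = cong suc (sum-replicate-zero n)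
∑-indicator-== {suc n} (suc u) = ∑-indicator-== u

∑-indicator-pair : ∀ {n} (u v : Fin n) → u ≢ v →
  ∑ (λ j → indicator ((j == u) ∨ (j == v))) ≡ 2
∑-indicator-pair zero    zero    u≢v = ⊥-elim (u≢v refl)
∑-indicator-pair zero    (suc v) _   = cong suc (∑-indicator-== v)
∑-indicator-pair (suc u) zero    _   =
  cong suc (trans (sum-cong-≗ (λ j → cong indicator (∨-identityʳ (j == u)))) (∑-indicator-== u))
∑-indicator-pair (suc u) (suc v) u≢v = ∑-indicator-pair u v (u≢v ∘ cong suc)

conAdj-irrefl : ∀ {n} (T : TwoTreeCon n) (i : Fin n) → conAdj T i i ≡ false
conAdj-irrefl triangle          i       rewrite ≡ᵇ-refl (toℕ i) = refl
conAdj-irrefl (extend T u v uv) zero    = refl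
conAdj-irrefl (extend T u v uv) (suc i) = conAdj-irrefl T i

conAdj-edge⇒≢ : ∀ {n} (T : TwoTreeCon n) {u v : Fin n} → conAdj T u v ≡ true → u ≢ v
conAdj-edge⇒≢ T {u} uv refl with trans (sym (conAdj-irrefl T u)) uv
... | ()

degreeSum-twoTree : ∀ {n} (T : TwoTreeCon n) → degreeSum (conAdj T) + 6 ≡ 4 * n
degreeSum-twoTree triangle = refl
degreeSum-twoTree {suc n} (extend T u v uv) = begin
  ends + (∑ λ i → indicator ((i == u) ∨ (i == v)) + row i) + 6
    ≡⟨ cong (λ s → ends + s + 6) (∑-distrib-+ _ row) ⟩
  ends + (ends + degreeSum (conAdj T)) + 6
    ≡⟨ cong (λ e → e + (e + degreeSum (conAdj T)) + 6)
            (∑-indicator-pair u v (conAdj-edge⇒≢ T uv)) ⟩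
  4 + (degreeSum (conAdj T) + 6)
    ≡⟨ cong (4 +_) (degreeSum-twoTree T) ⟩
  4 + 4 * n
    ≡⟨ sym (*-suc 4 n) ⟩
  4 * suc n ∎
  where
  ends : ℕ
  ends = ∑ λ j → indicator ((j == u) ∨ (j == v))
  row : Fin n → ℕ
  row i = ∑ λ j → indicator (conAdj T i j)

handshake-twoTree : ∀ {n} (G : Graph n) → IsTwoTree G → sum (degSeq G) + 6 ≡ 4 * n
handshake-twoTree {n} G (T , σ , G≅T) = begin
  sum (degSeq G) + 6        ≡⟨ cong (_+ 6) (trans (sum-degSeq G) (degreeSum-relabel σ G≅T)) ⟩
  degreeSum (conAdj T) + 6  ≡⟨ degreeSum-twoTree T ⟩
  4 * n ∎

-- Shaped like tailCount, so that count (isTail Δ k ∘ deg G) is tailCount G Δ k by definition.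
isTail : ℕ → ℕ → ℕ → Bool
isTail Δ k d = not (d ≡ᵇ Δ) ∧ (d ≡ᵇ k)

countᴸ : (ℕ → Bool) → List ℕ → ℕ
countᴸ q ds = sum (map (indicator ∘ q) ds)

count-deg : ∀ {n} (G : Graph n) (q : ℕ → Bool) → count (q ∘ deg G) ≡ countᴸ q (degSeq G)
count-deg {n} G q = cong sum (map-∘ (allFin n))

TailDegree23 : ℕ → ℕ → Set
TailDegree23 Δ d = (d ≡ᵇ Δ) ≡ false → (d ≡ᵇ 2) ∨ (d ≡ᵇ 3) ≡ true

data DegreeClass (Δ : ℕ) : ℕ → Set where
  core  : DegreeClass Δ Δ
  tail₃ : (3 ≡ᵇ Δ) ≡ false → DegreeClass Δ 3
  tail₂ : (2 ≡ᵇ Δ) ≡ false → DegreeClass Δ 2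

tailDegreeClass : ∀ {Δ} d → (d ≡ᵇ Δ) ≡ false → (d ≡ᵇ 2) ∨ (d ≡ᵇ 3) ≡ true → DegreeClass Δ d
tailDegreeClass 2 notCore _ = tail₂ notCore
tailDegreeClass 3 notCore _ = tail₃ notCore
tailDegreeClass 0 _ ()
tailDegreeClass 1 _ ()
tailDegreeClass (suc (suc (suc (suc _)))) _ ()

degreeClass : ∀ Δ d → TailDegree23 Δ d → DegreeClass Δ d
degreeClass Δ d tail23 with d ≡ᵇ Δ in isCore
... | true  = subst (DegreeClass Δ) (sym (≡ᵇ⇒≡ d Δ (subst T (sym isCore) _))) core
... | false = tailDegreeClass d isCore (tail23 refl)

profile : ℕ → ℕ → ℕ → ℕ → List ℕ
profile Δ r x y = replicate r Δ ++ replicate x 3 ++ replicate y 2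

profile-cons : ∀ {Δ d} → DegreeClass Δ d → ∀ r x y →
  d ∷ profile Δ r x y
    ↭ profile Δ (indicator (d ≡ᵇ Δ) + r) (indicator (isTail Δ 3 d) + x)
                (indicator (isTail Δ 2 d) + y)
profile-cons {Δ} core r x y rewrite ≡ᵇ-refl Δ = ↭-refl
profile-cons {Δ} (tail₃ notCore) r x y rewrite notCore = ↭-sym (shift 3 (replicate r Δ) _)
profile-cons {Δ} (tail₂ notCore) r x y rewrite notCore =
  ↭-sym (↭-trans (++⁺ˡ cores (shift 2 threes _)) (shift 2 cores (threes ++ _)))
  where
  cores threes : List ℕ
  cores  = replicate r Δ
  threes = replicate x 3

degreeSplit : ∀ {A : Set} Δ (f : A → ℕ) → (∀ a → TailDegree23 Δ (f a)) → ∀ as →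
  let ds = map f as in
  ds ↭ profile Δ (countᴸ (_≡ᵇ Δ) ds) (countᴸ (isTail Δ 3) ds) (countᴸ (isTail Δ 2) ds)
degreeSplit Δ f tail23 []       = ↭-refl
degreeSplit Δ f tail23 (a ∷ as) =
  ↭-trans (prep (f a) (degreeSplit Δ f tail23 as))
          (profile-cons (degreeClass Δ (f a) (tail23 a)) _ _ _)

degSeq-split : ∀ {n} (G : Graph n) Δ → TailSet23 G Δ →
  degSeq G ↭ profile Δ (count (inCore G Δ)) (tailCount G Δ 3) (tailCount G Δ 2)
degSeq-split {n} G Δ tail23
  rewrite count-deg G (_≡ᵇ Δ) | count-deg G (isTail Δ 3) | count-deg G (isTail Δ 2) =
  degreeSplit Δ (deg G) tail23 (allFin n)

length-degSeq : ∀ {n} (G : Graph n) → length (degSeq G) ≡ n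
length-degSeq {n} G = trans (length-map (deg G) (allFin n)) (length-tabulate (λ i → i))

length-profile : ∀ Δ r x y → length (profile Δ r x y) ≡ r + (x + y)
length-profile Δ r x y = begin
  length (replicate r Δ ++ replicate x 3 ++ replicate y 2)
    ≡⟨ length-++ (replicate r Δ) ⟩
  length (replicate r Δ) + length (replicate x 3 ++ replicate y 2)
    ≡⟨ cong (length (replicate r Δ) +_) (length-++ (replicate x 3)) ⟩
  length (replicate r Δ) + (length (replicate x 3) + length (replicate y 2))
    ≡⟨ cong₂ _+_ (length-replicate r) (cong₂ _+_ (length-replicate x) (length-replicate y)) ⟩
  r + (x + y) ∎

sum-profile : ∀ Δ r x y → sum (profile Δ r x y) ≡ r * Δ + (x * 3 + y * 2)
sum-profile Δ r x y = begin
  sum (replicate r Δ ++ replicate x 3 ++ replicate y 2)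
    ≡⟨ sum-++ (replicate r Δ) _ ⟩
  sum (replicate r Δ) + sum (replicate x 3 ++ replicate y 2)
    ≡⟨ cong (sum (replicate r Δ) +_) (sum-++ (replicate x 3) _) ⟩
  sum (replicate r Δ) + (sum (replicate x 3) + sum (replicate y 2))
    ≡⟨ cong₂ _+_ (sum-replicate r Δ) (cong₂ _+_ (sum-replicate x 3) (sum-replicate y 2)) ⟩
  r * Δ + (x * 3 + y * 2) ∎

vertexCount-profile : ∀ {n} (G : Graph n) Δ r x y → degSeq G ↭ profile Δ r x y →
  n ≡ r + (x + y)
vertexCount-profile {n} G Δ r x y split = begin
  n                         ≡⟨ length-degSeq G ⟨
  length (degSeq G)         ≡⟨ ↭-length split ⟩
  length (profile Δ r x y)  ≡⟨ length-profile Δ r x y ⟩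
  r + (x + y)               ∎

handshake-profile : ∀ {n} (G : Graph n) Δ r x y → IsTwoTree G → degSeq G ↭ profile Δ r x y →
  r * Δ + (x * 3 + y * 2) + 6 ≡ 4 * n
handshake-profile {n} G Δ r x y twoTree split = begin
  r * Δ + (x * 3 + y * 2) + 6  ≡⟨ cong (_+ 6) (sum-profile Δ r x y) ⟨
  sum (profile Δ r x y) + 6    ≡⟨ cong (_+ 6) (sum-↭ split) ⟨
  sum (degSeq G) + 6           ≡⟨ handshake-twoTree G twoTree ⟩
  4 * n                        ∎

tail₃-count : ∀ {n} Δ r x y → n ≡ r + (x + y) → r * Δ + (x * 3 + y * 2) + 6 ≡ 4 * n →
  x + r * Δ + 6 ≡ 2 * n + 2 * r
tail₃-count Δ r x y refl handshake = +-cancelʳ-≡ (2 * x + 2 * y) (x + r * Δ + 6) _ (begin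
  x + r * Δ + 6 + (2 * x + 2 * y)              ≡⟨ solve (x ∷ y ∷ r ∷ Δ ∷ []) ⟩
  r * Δ + (x * 3 + y * 2) + 6                  ≡⟨ handshake ⟩
  4 * (r + (x + y))                            ≡⟨ solve (x ∷ y ∷ r ∷ []) ⟩
  2 * (r + (x + y)) + 2 * r + (2 * x + 2 * y)  ∎)

tail₂-count : ∀ {n} Δ r x y → n ≡ r + (x + y) → r * Δ + (x * 3 + y * 2) + 6 ≡ 4 * n →
  y + n + 3 * r ≡ r * Δ + 6
tail₂-count Δ r x y refl handshake =
  +-cancelʳ-≡ (x * 3 + y * 2) (y + (r + (x + y)) + 3 * r) _ (begin
  y + (r + (x + y)) + 3 * r + (x * 3 + y * 2)  ≡⟨ solve (x ∷ y ∷ r ∷ []) ⟩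
  4 * (r + (x + y))                            ≡⟨ handshake ⟨
  r * Δ + (x * 3 + y * 2) + 6                  ≡⟨ solve (x ∷ y ∷ r ∷ Δ ∷ []) ⟩
  r * Δ + 6 + (x * 3 + y * 2)                  ∎)

m+n≡o⇒o∸n≡m : ∀ {m n o} → m + n ≡ o → o ∸ n ≡ m
m+n≡o⇒o∸n≡m {m} {n} refl = m+n∸n≡m m n

m+n+o≡p⇒p∸[o+n]≡m : ∀ m n o {p} → m + n + o ≡ p → p ∸ (o + n) ≡ m
m+n+o≡p⇒p∸[o+n]≡m m n o eq =
  m+n≡o⇒o∸n≡m (trans (cong (m +_) (+-comm o n)) (trans (sym (+-assoc m n o)) eq))

m+n+o≡p⇒p∸[n+o]≡m : ∀ m n o {p} → m + n + o ≡ p → p ∸ (n + o) ≡ m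
m+n+o≡p⇒p∸[n+o]≡m m n o eq = m+n≡o⇒o∸n≡m (trans (sym (+-assoc m n o)) eq)

lemma2p1 : (n r Δ : ℕ) (G : Graph n) →
    1 ≤ r → r ≤ 3 → 2 ≤ Δ →
    IsTwoTree G → IsCentral G r Δ → IsStrong G Δ → TailSet23 G Δ →
    (tailCount G Δ 3 + r * Δ + 6 ≡ 2 * n + 2 * r)
    × (tailCount G Δ 2 + n + 3 * r ≡ r * Δ + 6)
    × (degSeq G ↭ (replicate r Δ ++ replicate (2 * n + 2 * r ∸ (6 + r * Δ)) 3
                    ++ replicate (r * Δ + 6 ∸ (n + 3 * r)) 2))
lemma2p1 n r Δ G _ _ _ twoTree (_ , coreCount) _ tail23 = x-formula , y-formula , degSeq↭profile
  where
  x y : ℕ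
  x = tailCount G Δ 3
  y = tailCount G Δ 2

  split : degSeq G ↭ profile Δ r x y
  split = subst (λ c → degSeq G ↭ profile Δ c x y) coreCount (degSeq-split G Δ tail23)

  vertexCount : n ≡ r + (x + y)
  vertexCount = vertexCount-profile G Δ r x y split

  handshake : r * Δ + (x * 3 + y * 2) + 6 ≡ 4 * n
  handshake = handshake-profile G Δ r x y twoTree split

  x-formula : x + r * Δ + 6 ≡ 2 * n + 2 * r
  x-formula = tail₃-count Δ r x y vertexCount handshake

  y-formula : y + n + 3 * r ≡ r * Δ + 6
  y-formula = tail₂-count Δ r x y vertexCount handshake

  degSeq↭profile : degSeq G ↭ profile Δ r (2 * n + 2 * r ∸ (6 + r * Δ)) (r * Δ + 6 ∸ (n + 3 * r))
  degSeq↭profile = subst₂ (λ x′ y′ → degSeq G ↭ profile Δ r x′ y′)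
    (sym (m+n+o≡p⇒p∸[o+n]≡m x (r * Δ) 6 x-formula))
    (sym (m+n+o≡p⇒p∸[n+o]≡m y n (3 * r) y-formula))
    split
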